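{- Let $m,n\ge2$, $a,b\in A$, and $u,v\in A^*$ with factorizations $u=u_-au_0bu_+$ and $v=v_-av_0bv_+$ such that $a\notin\mathsf{alph}(u_0bu_+)\cup\mathsf{alph}(v_0bv_+)$ and $b\notin\mathsf{alph}(u_-au_0)\cup\mathsf{alph}(v_-av_0)$. If $u\equiv_{m,n}v$, then $u_0\equiv_{m-1,n-1}v_0$.
   Context: $A$ is a finite alphabet; $\mathsf{alph}(w)$ is the set of letters of $w$. Rankers: for $u=a_1\cdots a_k\in A^*$ and $x\in\{0,\dots,k+1\}$, $\mathsf X_a(u,x)=\min\{y:y>x,\ a_y=a\}$, $\mathsf Y_a(u,x)=\max\{y:y<x,\ a_y=a\}$ (undefined if the set is empty), $\mathsf X_a(u)=\mathsf X_a(u,0)$, $\mathsf Y_a(u)=\mathsf Y_a(u,k+1)$. A ranker is a nonempty word over $\{\mathsf X_a,\mathsf Y_a:a\in A\}$; for $r=\mathsf Zs$ with $\mathsf Z$ a single letter, $r(u,x)=s(u,\mathsf Z(u,x))$, $r(u)=s(u,\mathsf Z(u))$ (for a one-letter ranker $r(u)=\mathsf Z(u)$); a ranker defines one position of $u$ or is undefined. Depth = length; a block is a maximal factor of only $\mathsf X$-letters or only $\mathsf Y$-letters. $R_{m,n}$: rankers of depth $\le n$ with $\le m$ blocks; $R^{\mathsf X}_{m,n}$ (resp. $R^{\mathsf Y}_{m,n}$): those starting with an $\mathsf X_a$ (resp. $\mathsf Y_a$). $\mathrm{ord}(i,j)\in\{<,=,>\}$ is the order type of positions $i,j$. $u\equiv_{m,n}v$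 iff (1) the same rankers of $R_{m,n}$ are defined on $u$ and $v$, and, whenever $r,s$ are defined, $\mathrm{ord}(r(u),s(u))=\mathrm{ord}(r(v),s(v))$ for (2) $r\in R^{\mathsf X}_{m,n}$, $s\in R^{\mathsf Y}_{m,n-1}$; (3) $r\in R^{\mathsf Y}_{m,n}$, $s\in R^{\mathsf X}_{m,n-1}$; (4) $r\in R^{\mathsf X}_{m,n}$, $s\in R^{\mathsf X}_{m-1,n-1}$; (5) $r\in R^{\mathsf Y}_{m,n}$, $s\in R^{\mathsf Y}_{m-1,n-1}$. -}

module Defs where

open import Data.Nat using (ℕ; zero; suc; _≤_; _∸_; _<ᵇ_)
open import Data.Bool using (Bool; true; false; if_then_else_)
open import Data.List using (List; []; _∷_; drop; take; length)
open import Data.List.NonEmpty using (List⁺; _∷_; toList)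
open import Data.Maybe using (Maybe; just; nothing; _>>=_)
open import Data.Maybe.Relation.Unary.Any using () renaming (Any to MAny)
open import Data.Product using (_×_; _,_)
open import Data.Unit using (⊤)
open import Relation.Nullary using (yes; no)
open import Relation.Binary.Definitions using (DecidableEquality)
open import Relation.Binary.PropositionalEquality using (_≡_)

data Dir : Set where
  𝕏 𝕐 : Dir

sameDir : Dir → Dir → Bool
sameDir 𝕏 𝕏 = true
sameDir 𝕐 𝕐 = true
sameDir _ _ = false

data Ord3 : Set where
  lt eq gt : Ord3

ord : ℕ → ℕ → Ord3
ord i j = if i <ᵇ j then lt else (if j <ᵇ i then gt else eq)

module Rankers {A : Set} (_≟_ : DecidableEquality A) where

  -- Words are lists; positions are 1-indexed, position 0 and |u|+1 are the borders.

  -- first position ≥ p carrying letter a, in a word whose first letter sits at position p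
  findFirst : A → List A → ℕ → Maybe ℕ
  findFirst a [] p = nothing
  findFirst a (c ∷ w) p with a ≟ c
  ... | yes _ = just p
  ... | no _  = findFirst a w (suc p)

  -- last position carrying letter a, in a word whose first letter sits at position p
  findLast : A → List A → ℕ → Maybe ℕ
  findLast a [] p = nothing
  findLast a (c ∷ w) p with findLast a w (suc p)
  ... | just q = just q
  ... | nothing with a ≟ c
  ...   | yes _ = just p
  ...   | no _  = nothing

  -- X_a(u,x) = min{ y > x : a_y = a }
  Xpos : A → List A → ℕ → Maybe ℕ
  Xpos a u x = findFirst a (drop x u) (suc x)

  -- Y_a(u,x) = max{ y < x : a_y = a }
  Ypos : A → List A → ℕ → Maybe ℕ
  Ypos a u x = findLast a (take (x ∸ 1) u) 1

  step : Dir × A → List A → ℕ → Maybe ℕ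
  step (𝕏 , a) u x = Xpos a u x
  step (𝕐 , a) u x = Ypos a u x

  Ranker : Set
  Ranker = List⁺ (Dir × A)

  run : List (Dir × A) → List A → ℕ → Maybe ℕ
  run [] u x = just x
  run (z ∷ s) u x = step z u x >>= run s u

  -- starting position: X_a(u) = X_a(u,0), Y_a(u) = Y_a(u,|u|+1)
  start : Dir → List A → ℕ
  start 𝕏 u = 0
  start 𝕐 u = suc (length u)

  eval : Ranker → List A → Maybe ℕ
  eval ((d , a) ∷ s) u = run ((d , a) ∷ s) u (start d u)

  depth : Ranker → ℕ
  depth r = length (toList r)

  blocksFrom : Dir → List (Dir × A) → ℕ
  blocksFrom d [] = 1
  blocksFrom d ((d' , _) ∷ s) = if sameDir d d' then blocksFrom d' s else suc (blocksFrom d' s)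

  -- number of blocks (maximal factors of X-letters only or Y-letters only)
  blocks : Ranker → ℕ
  blocks ((d , _) ∷ s) = blocksFrom d s

  firstDir : Ranker → Dir
  firstDir ((d , _) ∷ _) = d

  InR : ℕ → ℕ → Ranker → Set
  InR m n r = (depth r ≤ n) × (blocks r ≤ m)

  InRX : ℕ → ℕ → Ranker → Set
  InRX m n r = InR m n r × (firstDir r ≡ 𝕏)

  InRY : ℕ → ℕ → Ranker → Set
  InRY m n r = InR m n r × (firstDir r ≡ 𝕐)

  Defined : Ranker → List A → Set
  Defined r u = MAny (λ _ → ⊤) (eval r u)

  SameOrd : Ranker → Ranker → List A → List A → Set
  SameOrd r s u v = ∀ {i j i' j'} → eval r u ≡ just i → eval s u ≡ just j →
                    eval r v ≡ just i' → eval s v ≡ just j' → ord i j ≡ ord i' j'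

  record Equiv (m n : ℕ) (u v : List A) : Set where
    field
      defined : ∀ r → InR m n r → (Defined r u → Defined r v) × (Defined r v → Defined r u)
      condXY : ∀ r s → InRX m n r → InRY m (n ∸ 1) s → SameOrd r s u v
      condYX : ∀ r s → InRY m n r → InRX m (n ∸ 1) s → SameOrd r s u v
      condXX : ∀ r s → InRX m n r → InRX (m ∸ 1) (n ∸ 1) s → SameOrd r s u v
      condYY : ∀ r s → InRY m n r → InRY (m ∸ 1) (n ∸ 1) s → SameOrd r s u v

-- A ranker r on u₀ is simulated on u by prefixing it with Y_a if r starts with an X-letter and
-- with X_b if it starts with a Y-letter: Y_a(u) and X_b(u) are the borders of the factor u₀, so the
-- prefixed ranker, with one more letter and one more block, evaluates to r(u₀) shifted by |u₋a|.
-- The order conditions for (u₀, v₀) are therefore instances of those for (u, v) with X and Y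
-- exchanged.  Definedness transfers letter by letter: if a step of r succeeds in u₀ but fails in v₀,
-- the corresponding step in v leaves the factor, so the prefixed ranker up to this step is ordered
-- differently against X_b (for an X-step) or Y_a (for a Y-step) on u and on v.

module Submission where

open import Defs
open import Data.Bool using (true; false; T)
open import Data.Empty using (⊥; ⊥-elim)
open import Data.Fin using (Fin)
open import Data.List using (List; []; _∷_; _++_; length; take; drop)
open import Data.List.Properties
  using (++-assoc; length-++; length-++-≤ˡ; length-drop; length-take; drop-all; take-all)
open import Data.List.Membership.Propositional using (_∉_)
open import Data.List.NonEmpty using (_∷_; toList)
open import Data.List.Relation.Unary.Any using (here; there)
open import Data.Maybe using (just; nothing; _>>=_) renaming (map to mapMaybe)
open import Data.Maybe.Properties using (just-injective)
open import Data.Maybe.Relation.Unary.Any using (just)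
open import Data.Nat using (ℕ; zero; suc; _≤_; _<_; _∸_; _+_; z≤n; s≤s; s≤s⁻¹; _≤?_; _<ᵇ_)
open import Data.Nat.Properties
open import Data.Product using (∃; _×_; _,_; proj₁; proj₂; swap)
open import Data.Unit using (tt)
open import Function using (_∘_)
open import Function.Bundles using (_↔_)
open import Relation.Nullary using (yes; no)
open import Relation.Binary.Definitions using (DecidableEquality)
open import Relation.Binary.PropositionalEquality

<⇒ord≡lt : ∀ {i j} → i < j → ord i j ≡ lt
<⇒ord≡lt {i} {j} i<j with i <ᵇ j | <⇒<ᵇ i<j
... | true | _ = refl

>⇒ord≡gt : ∀ {i j} → j < i → ord i j ≡ gt
>⇒ord≡gt {i} {j} j<i with i <ᵇ j in e | j <ᵇ i | <⇒<ᵇ j<i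
... | true  | _    | _ = ⊥-elim (<-asym j<i (<ᵇ⇒< i j (subst T (sym e) tt)))
... | false | true | _ = refl

ord≡lt⇒< : ∀ {i j} → ord i j ≡ lt → i < j
ord≡lt⇒< {i} {j} h with i <ᵇ j in e | j <ᵇ i
ord≡lt⇒< {i} {j} h  | true  | _     = <ᵇ⇒< i j (subst T (sym e) tt)
ord≡lt⇒< {i} {j} () | false | true
ord≡lt⇒< {i} {j} () | false | false

ord≡gt⇒> : ∀ {i j} → ord i j ≡ gt → j < i
ord≡gt⇒> {i} {j} h with i <ᵇ j | j <ᵇ i in e
ord≡gt⇒> {i} {j} () | true  | _
ord≡gt⇒> {i} {j} h  | false | true = <ᵇ⇒< j i (subst T (sym e) tt)
ord≡gt⇒> {i} {j} () | false | false

ord-+ : ∀ k i j → ord (k + i) (k + j) ≡ ord i j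
ord-+ zero    i j = refl
ord-+ (suc k) i j = ord-+ k i j

module _ {A : Set} (_≟_ : DecidableEquality A) where
  open Rankers _≟_

  findFirst-≥ : ∀ c xs p {z} → findFirst c xs p ≡ just z → p ≤ z
  findFirst-≥ c (d ∷ xs) p h with c ≟ d
  ... | yes _ = ≤-reflexive (just-injective h)
  ... | no _  = ≤-trans (n≤1+n p) (findFirst-≥ c xs (suc p) h)

  findFirst-< : ∀ c xs p {z} → findFirst c xs p ≡ just z → z < p + length xs
  findFirst-< c (d ∷ xs) p {z} h with c ≟ d
  ... | yes _ = subst (_< p + suc (length xs)) (just-injective h) (m<m+n p (s≤s z≤n))
  ... | no _  = subst (z <_) (sym (+-suc p (length xs))) (findFirst-< c xs (suc p) h)

  findFirst-∉ : ∀ c xs p → c ∉ xs → findFirst c xs p ≡ nothing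
  findFirst-∉ c []       p c∉ = refl
  findFirst-∉ c (d ∷ xs) p c∉ with c ≟ d
  ... | yes c≡d = ⊥-elim (c∉ (here c≡d))
  ... | no _    = findFirst-∉ c xs (suc p) (c∉ ∘ there)

  findFirst-++-just : ∀ c xs ys p {z} → findFirst c xs p ≡ just z → findFirst c (xs ++ ys) p ≡ just z
  findFirst-++-just c (d ∷ xs) ys p h with c ≟ d
  ... | yes _ = h
  ... | no _  = findFirst-++-just c xs ys (suc p) h

  findFirst-++-nothing : ∀ c xs ys p → findFirst c xs p ≡ nothing →
                         findFirst c (xs ++ ys) p ≡ findFirst c ys (p + length xs)
  findFirst-++-nothing c []       ys p h = cong (findFirst c ys) (sym (+-identityʳ p))
  findFirst-++-nothing c (d ∷ xs) ys p h with c ≟ d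
  findFirst-++-nothing c (d ∷ xs) ys p () | yes _
  ... | no _ = trans (findFirst-++-nothing c xs ys (suc p) h) (cong (findFirst c ys) (sym (+-suc p (length xs))))

  findFirst-+ : ∀ c xs k p → findFirst c xs (k + p) ≡ mapMaybe (k +_) (findFirst c xs p)
  findFirst-+ c []       k p = refl
  findFirst-+ c (d ∷ xs) k p with c ≟ d
  ... | yes _ = refl
  ... | no _  = trans (cong (findFirst c xs) (sym (+-suc k p))) (findFirst-+ c xs k (suc p))

  findLast-≥ : ∀ c xs p {z} → findLast c xs p ≡ just z → p ≤ z
  findLast-≥ c (d ∷ xs) p h with findLast c xs (suc p) in e
  ... | just _ = ≤-trans (n≤1+n p) (findLast-≥ c xs (suc p) (trans e h))
  ... | nothing with c ≟ d
  ...   | yes _ = ≤-reflexive (just-injective h)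
  findLast-≥ c (d ∷ xs) p () | nothing | no _

  findLast-< : ∀ c xs p {z} → findLast c xs p ≡ just z → z < p + length xs
  findLast-< c (d ∷ xs) p {z} h with findLast c xs (suc p) in e
  ... | just _ = subst (z <_) (sym (+-suc p (length xs))) (findLast-< c xs (suc p) (trans e h))
  ... | nothing with c ≟ d
  ...   | yes _ = subst (_< p + suc (length xs)) (just-injective h) (m<m+n p (s≤s z≤n))
  findLast-< c (d ∷ xs) p () | nothing | no _

  findLast-∉ : ∀ c xs p → c ∉ xs → findLast c xs p ≡ nothing
  findLast-∉ c []       p c∉ = refl
  findLast-∉ c (d ∷ xs) p c∉ rewrite findLast-∉ c xs (suc p) (λ c∈ → c∉ (there c∈)) with c ≟ d
  ... | yes c≡d = ⊥-elim (c∉ (here c≡d))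
  ... | no _    = refl

  findLast-++-just : ∀ c xs ys p {z} → findLast c ys (p + length xs) ≡ just z → findLast c (xs ++ ys) p ≡ just z
  findLast-++-just c []       ys p h = trans (cong (findLast c ys) (sym (+-identityʳ p))) h
  findLast-++-just c (d ∷ xs) ys p h
    rewrite findLast-++-just c xs ys (suc p) (trans (cong (findLast c ys) (sym (+-suc p (length xs)))) h) = refl

  findLast-++-nothing : ∀ c xs ys p → findLast c ys (p + length xs) ≡ nothing →
                        findLast c (xs ++ ys) p ≡ findLast c xs p
  findLast-++-nothing c []       ys p h = trans (cong (findLast c ys) (sym (+-identityʳ p))) h
  findLast-++-nothing c (d ∷ xs) ys p h
    rewrite findLast-++-nothing c xs ys (suc p) (trans (cong (findLast c ys) (sym (+-suc p (length xs)))) h) = refl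

  findLast-+ : ∀ c xs k p → findLast c xs (k + p) ≡ mapMaybe (k +_) (findLast c xs p)
  findLast-+ c []       k p = refl
  findLast-+ c (d ∷ xs) k p rewrite sym (+-suc k p) | findLast-+ c xs k (suc p) with findLast c xs (suc p)
  ... | just _ = refl
  ... | nothing with c ≟ d
  ...   | yes _ = refl
  ...   | no _  = refl

  findFirst-first : ∀ c xs ys p → c ∉ xs → findFirst c (xs ++ c ∷ ys) p ≡ just (p + length xs)
  findFirst-first c xs ys p c∉ with c ≟ c | findFirst-++-nothing c xs (c ∷ ys) p (findFirst-∉ c xs p c∉)
  ... | yes _ | e = e
  ... | no c≢c | _ = ⊥-elim (c≢c refl)

  findLast-last : ∀ c xs ys p → c ∉ ys → findLast c (xs ++ c ∷ ys) p ≡ just (p + length xs)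
  findLast-last c xs ys p c∉ = findLast-++-just c xs (c ∷ ys) p last
    where
    last : findLast c (c ∷ ys) (p + length xs) ≡ just (p + length xs)
    last rewrite findLast-∉ c ys (suc (p + length xs)) c∉ with c ≟ c
    ... | yes _  = refl
    ... | no c≢c = ⊥-elim (c≢c refl)

  drop-++-length : ∀ (α γ : List A) x → drop (length α + x) (α ++ γ) ≡ drop x γ
  drop-++-length []      γ x = refl
  drop-++-length (_ ∷ α) γ x = drop-++-length α γ x

  take-++-length : ∀ (α γ : List A) k → take (length α + k) (α ++ γ) ≡ α ++ take k γ
  take-++-length []      γ k = refl
  take-++-length (c ∷ α) γ k = cong (c ∷_) (take-++-length α γ k)

  drop-++-≤ : ∀ x (w β : List A) → x ≤ length w → drop x (w ++ β) ≡ drop x w ++ β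
  drop-++-≤ zero    w       β _ = refl
  drop-++-≤ (suc x) (_ ∷ w) β (s≤s x≤) = drop-++-≤ x w β x≤

  take-++-≤ : ∀ k (w β : List A) → k ≤ length w → take k (w ++ β) ≡ take k w
  take-++-≤ zero    w       β _ = refl
  take-++-≤ (suc k) (c ∷ w) β (s≤s k≤) = cong (c ∷_) (take-++-≤ k w β k≤)

  length-drop-+ : ∀ x (w : List A) → x ≤ length w → suc x + length (drop x w) ≡ suc (length w)
  length-drop-+ x w x≤ = cong suc (trans (cong (x +_) (length-drop x w)) (m+[n∸m]≡n x≤))

  Xpos-beyond : ∀ c (w : List A) x → length w ≤ x → Xpos c w x ≡ nothing
  Xpos-beyond c w x w≤x rewrite drop-all x w w≤x = refl

  Xpos-≤ : ∀ c (w : List A) x {y} → Xpos c w x ≡ just y → (suc x ≤ y) × (y ≤ length w)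
  Xpos-≤ c w x {y} h with x ≤? length w
  ... | yes x≤ = findFirst-≥ c (drop x w) (suc x) h
               , s≤s⁻¹ (subst (y <_) (length-drop-+ x w x≤) (findFirst-< c (drop x w) (suc x) h))
  ... | no x≰ rewrite Xpos-beyond c w x (<⇒≤ (≰⇒> x≰)) with h
  ...   | ()

  Ypos-≤ : ∀ c (w : List A) x {y} → Ypos c w x ≡ just y → (1 ≤ y) × (y ≤ length w)
  Ypos-≤ c w x h = findLast-≥ c (take (x ∸ 1) w) 1 h
    , s≤s⁻¹ (≤-trans (findLast-< c (take (x ∸ 1) w) 1 h)
                     (s≤s (≤-trans (≤-reflexive (length-take (x ∸ 1) w)) (m⊓n≤n _ _))))

  Ypos-< : ∀ c (w : List A) x {y} → Ypos c w x ≡ just y → y < x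
  Ypos-< c w zero    ()
  Ypos-< c w (suc x) h = ≤-trans (findLast-< c (take x w) 1 h)
                                 (s≤s (≤-trans (≤-reflexive (length-take x w)) (m⊓n≤m _ _)))

  Xpos-++-length : ∀ c (α γ : List A) x →
                   Xpos c (α ++ γ) (length α + x) ≡ mapMaybe (length α +_) (Xpos c γ x)
  Xpos-++-length c α γ x = trans (cong₂ (findFirst c) (drop-++-length α γ x) (sym (+-suc (length α) x)))
                                 (findFirst-+ c (drop x γ) (length α) (suc x))

  Xpos-++ʳ-just : ∀ c (w β : List A) x {y} → Xpos c w x ≡ just y → Xpos c (w ++ β) x ≡ just y
  Xpos-++ʳ-just c w β x h
    rewrite drop-++-≤ x w β (<⇒≤ (≤-trans (proj₁ (Xpos-≤ c w x h)) (proj₂ (Xpos-≤ c w x h)))) =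
    findFirst-++-just c (drop x w) β (suc x) h

  Xpos-++ʳ-nothing : ∀ c (w β : List A) x {z} → Xpos c w x ≡ nothing →
                     Xpos c (w ++ β) x ≡ just z → suc (length w) ≤ z
  Xpos-++ʳ-nothing c w β x {z} h h′ with x ≤? length w
  ... | yes x≤ rewrite drop-++-≤ x w β x≤ =
    subst (_≤ z) (length-drop-+ x w x≤)
      (findFirst-≥ c β _ (trans (sym (findFirst-++-nothing c (drop x w) β (suc x) h)) h′))
  ... | no x≰ = ≤-trans (≰⇒> x≰) (≤-trans (n≤1+n x) (proj₁ (Xpos-≤ c (w ++ β) x h′)))

  Ypos-++-length : ∀ c (α γ : List A) k →
                   Ypos c (α ++ γ) (length α + suc k) ≡ findLast c (α ++ take k γ) 1
  Ypos-++-length c α γ k = cong (λ t → findLast c t 1)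
    (trans (cong (λ t → take (t ∸ 1) (α ++ γ)) (+-suc (length α) k)) (take-++-length α γ k))

  findLast-take-++ : ∀ c (α w β : List A) k → k ≤ length w →
                     findLast c (take k (w ++ β)) (1 + length α) ≡ mapMaybe (length α +_) (Ypos c w (suc k))
  findLast-take-++ c α w β k k≤ = begin
    findLast c (take k (w ++ β)) (1 + length α)
      ≡⟨ cong (findLast c (take k (w ++ β))) (+-comm 1 (length α)) ⟩
    findLast c (take k (w ++ β)) (length α + 1)
      ≡⟨ findLast-+ c (take k (w ++ β)) (length α) 1 ⟩
    mapMaybe (length α +_) (findLast c (take k (w ++ β)) 1)
      ≡⟨ cong (λ t → mapMaybe (length α +_) (findLast c t 1)) (take-++-≤ k w β k≤) ⟩
    mapMaybe (length α +_) (findLast c (take k w) 1)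
      ∎
    where open ≡-Reasoning

  step-inside : ∀ z (w : List A) x {y} → step z w x ≡ just y → (1 ≤ y) × (y ≤ length w)
  step-inside (𝕏 , c) w x h = ≤-trans (s≤s z≤n) (proj₁ (Xpos-≤ c w x h)) , proj₂ (Xpos-≤ c w x h)
  step-inside (𝕐 , c) w x h = Ypos-≤ c w x h

  step-embed : ∀ z (α w β : List A) x {y} → x ≤ suc (length w) → step z w x ≡ just y →
               step z (α ++ w ++ β) (length α + x) ≡ just (length α + y)
  step-embed (𝕏 , c) α w β x hx h =
    trans (Xpos-++-length c α (w ++ β) x) (cong (mapMaybe (length α +_)) (Xpos-++ʳ-just c w β x h))
  step-embed (𝕐 , c) α w β (suc k) hx h =
    trans (Ypos-++-length c α (w ++ β) k)
      (findLast-++-just c α (take k (w ++ β)) 1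
        (trans (findLast-take-++ c α w β k (s≤s⁻¹ hx)) (cong (mapMaybe (length α +_)) h)))

  X-escape : ∀ c (α w β : List A) x {z} → Xpos c w x ≡ nothing →
             Xpos c (α ++ w ++ β) (length α + x) ≡ just z → length α + suc (length w) ≤ z
  X-escape c α w β x h h′ with Xpos c (w ++ β) x in e | trans (sym (Xpos-++-length c α (w ++ β) x)) h′
  ... | just z₀ | refl = +-monoʳ-≤ (length α) (Xpos-++ʳ-nothing c w β x h e)

  Y-escape : ∀ c (α w β : List A) x {z} → x ≤ suc (length w) → Ypos c w x ≡ nothing →
             Ypos c (α ++ w ++ β) (length α + x) ≡ just z → z ≤ length α
  Y-escape c α w β zero    hx h h′ = <⇒≤ (subst (_ <_) (+-identityʳ (length α)) (Ypos-< c _ _ h′))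
  Y-escape c α w β (suc k) {z} hx h h′ = s≤s⁻¹ (findLast-< c α 1 (begin
    findLast c α 1
      ≡⟨ findLast-++-nothing c α (take k (w ++ β)) 1
           (trans (findLast-take-++ c α w β k (s≤s⁻¹ hx)) (cong (mapMaybe (length α +_)) h)) ⟨
    findLast c (α ++ take k (w ++ β)) 1
      ≡⟨ Ypos-++-length c α (w ++ β) k ⟨
    Ypos c (α ++ w ++ β) (length α + suc k)
      ≡⟨ h′ ⟩
    just z
      ∎))
    where open ≡-Reasoning

  run-embed : ∀ s (α w β : List A) x {y} → x ≤ suc (length w) → run s w x ≡ just y →
              run s (α ++ w ++ β) (length α + x) ≡ just (length α + y)
  run-embed []      α w β x hx h = cong (λ t → just (length α + t)) (just-injective h)
  run-embed (z ∷ s) α w β x hx h with step z w x in e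
  ... | just y₁ rewrite step-embed z α w β x hx e =
    run-embed s α w β y₁ (≤-trans (proj₂ (step-inside z w x e)) (n≤1+n _)) h

  run-∷ʳ : ∀ z l u x → run (l ++ z ∷ []) u x ≡ (run l u x >>= step z u)
  run-∷ʳ z []      u x with step z u x
  ... | nothing = refl
  ... | just _  = refl
  run-∷ʳ z (z′ ∷ l) u x with step z′ u x
  ... | nothing = refl
  ... | just y  = run-∷ʳ z l u y

  eval-∷ʳ : ∀ h pre z u → eval (h ∷ (pre ++ z ∷ [])) u ≡ (eval (h ∷ pre) u >>= step z u)
  eval-∷ʳ (d , c) pre z u = run-∷ʳ z ((d , c) ∷ pre) u (start d u)

  Defined⇒just : ∀ {r u} → Defined r u → ∃ λ i → eval r u ≡ just i
  Defined⇒just {r} {u} d with eval r u | d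
  ... | just i | _ = i , refl

  just⇒Defined : ∀ {r u i} → eval r u ≡ just i → Defined r u
  just⇒Defined e rewrite e = just tt

  Equiv-sym : ∀ {m n u v} → Equiv m n u v → Equiv m n v u
  Equiv-sym E = record
    { defined = λ r h → swap (Equiv.defined E r h)
    ; condXY  = λ r s hr hs h₁ h₂ h₃ h₄ → sym (Equiv.condXY E r s hr hs h₃ h₄ h₁ h₂)
    ; condYX  = λ r s hr hs h₁ h₂ h₃ h₄ → sym (Equiv.condYX E r s hr hs h₃ h₄ h₁ h₂)
    ; condXX  = λ r s hr hs h₁ h₂ h₃ h₄ → sym (Equiv.condXX E r s hr hs h₃ h₄ h₁ h₂)
    ; condYY  = λ r s hr hs h₁ h₂ h₃ h₄ → sym (Equiv.condYY E r s hr hs h₃ h₄ h₁ h₂)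
    }

  blocksFrom-≥1 : ∀ d l → 1 ≤ blocksFrom d l
  blocksFrom-≥1 d []            = s≤s z≤n
  blocksFrom-≥1 d ((d′ , _) ∷ l) with sameDir d d′
  ... | true  = blocksFrom-≥1 d′ l
  ... | false = s≤s z≤n

  blocksFrom-++ : ∀ d t₁ t₂ → blocksFrom d t₁ ≤ blocksFrom d (t₁ ++ t₂)
  blocksFrom-++ d []             t₂ = blocksFrom-≥1 d t₂
  blocksFrom-++ d ((d′ , _) ∷ t₁) t₂ with sameDir d d′
  ... | true  = blocksFrom-++ d′ t₁ t₂
  ... | false = s≤s (blocksFrom-++ d′ t₁ t₂)

  InR-∷ʳ-++ : ∀ {k l} h pre z s → InR k l (h ∷ (pre ++ z ∷ s)) → InR k l (h ∷ ((pre ++ z ∷ []) ++ s))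
  InR-∷ʳ-++ {k} {l} h pre z s = subst (λ t → InR k l (h ∷ t)) (sym (++-assoc pre (z ∷ []) s))

  InR-++⁻ˡ : ∀ {k l} h t₁ t₂ → InR k l (h ∷ (t₁ ++ t₂)) → InR k l (h ∷ t₁)
  InR-++⁻ˡ (d , _) t₁ t₂ (depth≤ , blocks≤) =
    ≤-trans (s≤s (length-++-≤ˡ t₁)) depth≤ , ≤-trans (blocksFrom-++ d t₁ t₂) blocks≤

  module _ (a b : A) where

    entry : Dir → Dir × A
    entry 𝕏 = 𝕐 , a
    entry 𝕐 = 𝕏 , b

    enter : Ranker → Ranker
    enter ((d , c) ∷ s) = entry d ∷ ((d , c) ∷ s)

    InR-enter : ∀ {k l} r → InR k l r → InR (suc k) (suc l) (enter r)
    InR-enter ((𝕏 , _) ∷ _) (depth≤ , blocks≤) = s≤s depth≤ , s≤s blocks≤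
    InR-enter ((𝕐 , _) ∷ _) (depth≤ , blocks≤) = s≤s depth≤ , s≤s blocks≤

    start-≤ : ∀ d (w : List A) → start d w ≤ suc (length w)
    start-≤ 𝕏 w = z≤n
    start-≤ 𝕐 w = ≤-refl

    record Frame (u w : List A) : Set where
      field
        α β     : List A
        split   : u ≡ α ++ w ++ β
        last-a  : Ypos a u (suc (length u)) ≡ just (length α)
        first-b : Xpos b u 0 ≡ just (length α + suc (length w))

    module Framed {u w : List A} (F : Frame u w) where
      open Frame F

      L H : ℕ
      L = length α
      H = L + suc (length w)

      step-lift : ∀ z x {y} → x ≤ suc (length w) → step z w x ≡ just y → step z u (L + x) ≡ just (L + y)
      step-lift z x {y} hx h rewrite split = step-embed z α w β x hx h

      X-escapes : ∀ c x {z} → Xpos c w x ≡ nothing → Xpos c u (L + x) ≡ just z → H ≤ z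
      X-escapes c x h rewrite split = X-escape c α w β x h

      Y-escapes : ∀ c x {z} → x ≤ suc (length w) → Ypos c w x ≡ nothing → Ypos c u (L + x) ≡ just z → z ≤ L
      Y-escapes c x hx h rewrite split = Y-escape c α w β x hx h

      eval-entry : ∀ d l → eval (entry d ∷ l) u ≡ run l u (L + start d w)
      eval-entry 𝕏 l rewrite last-a | +-identityʳ L = refl
      eval-entry 𝕐 l rewrite first-b = refl

      eval-enter : ∀ r {i} → eval r w ≡ just i → eval (enter r) u ≡ just (L + i)
      eval-enter ((d , c) ∷ s) h =
        trans (eval-entry d ((d , c) ∷ s))
          (subst (λ t → run ((d , c) ∷ s) t (L + start d w) ≡ _) (sym split)
            (run-embed ((d , c) ∷ s) α w β (start d w) (start-≤ d w) h))

      eval-∷ʳ-lift : ∀ h pre z x {y} → x ≤ suc (length w) → eval (h ∷ pre) u ≡ just (L + x) →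
                     step z w x ≡ just y → eval (h ∷ (pre ++ z ∷ [])) u ≡ just (L + y)
      eval-∷ʳ-lift h pre z x hx e s =
        trans (eval-∷ʳ h pre z u) (trans (cong (_>>= step z u) e) (step-lift z x hx s))

      eval-first-b : eval ((𝕏 , b) ∷ []) u ≡ just H
      eval-first-b rewrite first-b = refl

      eval-last-a : eval ((𝕐 , a) ∷ []) u ≡ just L
      eval-last-a rewrite last-a = refl

    module Transfer {m n : ℕ} {u v w w′ : List A}
                    (E : Equiv (2 + m) (2 + n) u v) (Fu : Frame u w) (Fv : Frame v w′) where
      module U = Framed Fu
      module V = Framed Fv

      ord-first-b : ∀ q {i i′} → InR (2 + m) (2 + n) q → eval q u ≡ just i → eval q v ≡ just i′ →
                    ord i U.H ≡ ord i′ V.H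
      ord-first-b q@((𝕏 , _) ∷ _) q∈ h h′ =
        Equiv.condXX E q ((𝕏 , b) ∷ []) (q∈ , refl) ((s≤s z≤n , s≤s z≤n) , refl)
          h U.eval-first-b h′ V.eval-first-b
      ord-first-b q@((𝕐 , _) ∷ _) q∈ h h′ =
        Equiv.condYX E q ((𝕏 , b) ∷ []) (q∈ , refl) ((s≤s z≤n , s≤s z≤n) , refl)
          h U.eval-first-b h′ V.eval-first-b

      ord-last-a : ∀ q {i i′} → InR (2 + m) (2 + n) q → eval q u ≡ just i → eval q v ≡ just i′ →
                   ord i U.L ≡ ord i′ V.L
      ord-last-a q@((𝕏 , _) ∷ _) q∈ h h′ =
        Equiv.condXY E q ((𝕐 , a) ∷ []) (q∈ , refl) ((s≤s z≤n , s≤s z≤n) , refl)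
          h U.eval-last-a h′ V.eval-last-a
      ord-last-a q@((𝕐 , _) ∷ _) q∈ h h′ =
        Equiv.condYY E q ((𝕐 , a) ∷ []) (q∈ , refl) ((s≤s z≤n , s≤s z≤n) , refl)
          h U.eval-last-a h′ V.eval-last-a

      no-escape : ∀ z q x′ {y k} → InR (2 + m) (2 + n) q → x′ ≤ suc (length w′) → 1 ≤ y → y ≤ length w →
                  eval q u ≡ just (U.L + y) → eval q v ≡ just k →
                  step z w′ x′ ≡ nothing → step z v (V.L + x′) ≡ just k → ⊥
      no-escape (𝕏 , c) q x′ q∈ hx′ 1≤y y≤ hu hv none escaped =
        <⇒≱ (ord≡lt⇒< (trans (sym (ord-first-b q q∈ hu hv)) (<⇒ord≡lt (+-monoʳ-< U.L (s≤s y≤)))))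
            (V.X-escapes c x′ none escaped)
      no-escape (𝕐 , c) q x′ q∈ hx′ 1≤y y≤ hu hv none escaped =
        <⇒≱ (ord≡gt⇒> (trans (sym (ord-last-a q q∈ hu hv)) (>⇒ord≡gt (m<m+n U.L 1≤y))))
            (V.Y-escapes c x′ hx′ none escaped)

      defined-from : ∀ d pre s x x′ {y} → InR (2 + m) (2 + n) (entry d ∷ (pre ++ s)) →
                     x ≤ suc (length w) → x′ ≤ suc (length w′) →
                     eval (entry d ∷ pre) u ≡ just (U.L + x) → eval (entry d ∷ pre) v ≡ just (V.L + x′) →
                     run s w x ≡ just y → ∃ λ y′ → run s w′ x′ ≡ just y′
      defined-from d pre []      x x′ r∈ hx hx′ hu hv h = x′ , refl
      defined-from d pre (z ∷ s) x x′ r∈ hx hx′ hu hv h with step z w x in e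
      ... | just y with step z w′ x′ in e′
      ...   | nothing =
        ⊥-elim (no-escape z q x′ q∈ hx′ (proj₁ (step-inside z w x e)) (proj₂ (step-inside z w x e))
                          hu′ (proj₂ k) e′ escaped)
        where
        q : Ranker
        q = entry d ∷ (pre ++ z ∷ [])
        q∈ : InR (2 + m) (2 + n) q
        q∈ = InR-++⁻ˡ (entry d) (pre ++ z ∷ []) s (InR-∷ʳ-++ (entry d) pre z s r∈)
        hu′ : eval q u ≡ just (U.L + y)
        hu′ = U.eval-∷ʳ-lift (entry d) pre z x hx hu e
        k : ∃ λ k → eval q v ≡ just k
        k = Defined⇒just {q} (proj₁ (Equiv.defined E q q∈) (just⇒Defined {q} hu′))
        escaped : step z v (V.L + x′) ≡ just (proj₁ k)
        escaped = trans (sym (trans (eval-∷ʳ (entry d) pre z v) (cong (_>>= step z v) hv))) (proj₂ k)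
      ...   | just y′ =
        defined-from d (pre ++ z ∷ []) s y y′
          (InR-∷ʳ-++ (entry d) pre z s r∈)
          (≤-trans (proj₂ (step-inside z w x e)) (n≤1+n _))
          (≤-trans (proj₂ (step-inside z w′ x′ e′)) (n≤1+n _))
          (U.eval-∷ʳ-lift (entry d) pre z x hx hu e) (V.eval-∷ʳ-lift (entry d) pre z x′ hx′ hv e′) h

      defined : ∀ r → InR (suc m) (suc n) r → Defined r w → Defined r w′
      defined r@((d , _) ∷ _) r∈ r↓ =
        just⇒Defined {r} (proj₂ (defined-from d [] (toList r) (start d w) (start d w′) (InR-enter r r∈)
          (start-≤ d w) (start-≤ d w′) (U.eval-entry d []) (V.eval-entry d [])
          (proj₂ (Defined⇒just {r} r↓))))

      sameOrd : ∀ r s → SameOrd (enter r) (enter s) u v → SameOrd r s w w′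
      sameOrd r s so {i} {j} {i′} {j′} h₁ h₂ h₃ h₄ = begin
        ord i j                    ≡⟨ ord-+ U.L i j ⟨
        ord (U.L + i) (U.L + j)    ≡⟨ so (U.eval-enter r h₁) (U.eval-enter s h₂)
                                         (V.eval-enter r h₃) (V.eval-enter s h₄) ⟩
        ord (V.L + i′) (V.L + j′)  ≡⟨ ord-+ V.L i′ j′ ⟩
        ord i′ j′                  ∎
        where open ≡-Reasoning

      condXY : ∀ r s → InRX (suc m) (suc n) r → InRY (suc m) n s → SameOrd r s w w′
      condXY r@((𝕏 , _) ∷ _) s@((𝕐 , _) ∷ _) (r∈ , refl) (s∈ , refl) =
        sameOrd r s (Equiv.condYX E (enter r) (enter s) (InR-enter r r∈ , refl) (InR-enter s s∈ , refl))

      condYX : ∀ r s → InRY (suc m) (suc n) r → InRX (suc m) n s → SameOrd r s w w′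
      condYX r@((𝕐 , _) ∷ _) s@((𝕏 , _) ∷ _) (r∈ , refl) (s∈ , refl) =
        sameOrd r s (Equiv.condXY E (enter r) (enter s) (InR-enter r r∈ , refl) (InR-enter s s∈ , refl))

      condXX : ∀ r s → InRX (suc m) (suc n) r → InRX m n s → SameOrd r s w w′
      condXX r@((𝕏 , _) ∷ _) s@((𝕏 , _) ∷ _) (r∈ , refl) (s∈ , refl) =
        sameOrd r s (Equiv.condYY E (enter r) (enter s) (InR-enter r r∈ , refl) (InR-enter s s∈ , refl))

      condYY : ∀ r s → InRY (suc m) (suc n) r → InRY m n s → SameOrd r s w w′
      condYY r@((𝕐 , _) ∷ _) s@((𝕐 , _) ∷ _) (r∈ , refl) (s∈ , refl) =
        sameOrd r s (Equiv.condXX E (enter r) (enter s) (InR-enter r r∈ , refl) (InR-enter s s∈ , refl))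

    Equiv-frame : ∀ {m n u v w w′} → Equiv (2 + m) (2 + n) u v → Frame u w → Frame v w′ →
                  Equiv (suc m) (suc n) w w′
    Equiv-frame E Fu Fv = record
      { defined = λ r r∈ → T.defined r r∈ , T′.defined r r∈
      ; condXY  = T.condXY
      ; condYX  = T.condYX
      ; condXX  = T.condXX
      ; condYY  = T.condYY
      }
      where
      module T  = Transfer E Fu Fv
      module T′ = Transfer (Equiv-sym E) Fv Fu

    factorisation-frame : ∀ u u₋ u₀ u₊ → u ≡ u₋ ++ a ∷ u₀ ++ b ∷ u₊ →
                          a ∉ u₀ ++ b ∷ u₊ → b ∉ u₋ ++ a ∷ u₀ → Frame u u₀
    factorisation-frame u u₋ u₀ u₊ refl a∉ b∉ = record
      { α       = u₋ ++ a ∷ []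
      ; β       = b ∷ u₊
      ; split   = sym (++-assoc u₋ (a ∷ []) (u₀ ++ b ∷ u₊))
      ; last-a  = trans (cong (λ t → findLast a t 1) (take-all (length u) u ≤-refl))
                        (trans (findLast-last a u₋ (u₀ ++ b ∷ u₊) 1 a∉)
                               (cong just (sym (trans (length-++ u₋) (+-comm (length u₋) 1)))))
      ; first-b = trans (cong (λ t → findFirst b t 1) (sym (++-assoc u₋ (a ∷ u₀) (b ∷ u₊))))
                        (trans (findFirst-first b (u₋ ++ a ∷ u₀) u₊ 1 b∉) (cong just position-b))
      }
      where
      position-b : 1 + length (u₋ ++ a ∷ u₀) ≡ length (u₋ ++ a ∷ []) + suc (length u₀)
      position-b rewrite length-++ u₋ {a ∷ u₀} | length-++ u₋ {a ∷ []} =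
        sym (trans (+-assoc (length u₋) 1 (suc (length u₀))) (+-suc (length u₋) (suc (length u₀))))

lemma5 : {A : Set} (_≟_ : DecidableEquality A) → (∃ λ k → A ↔ Fin k) →
    (m n : ℕ) → 2 ≤ m → 2 ≤ n → (a b : A) →
    (u v u₋ u₀ u₊ v₋ v₀ v₊ : List A) →
    u ≡ u₋ ++ a ∷ u₀ ++ b ∷ u₊ →
    v ≡ v₋ ++ a ∷ v₀ ++ b ∷ v₊ →
    a ∉ u₀ ++ b ∷ u₊ → a ∉ v₀ ++ b ∷ v₊ →
    b ∉ u₋ ++ a ∷ u₀ → b ∉ v₋ ++ a ∷ v₀ →
    Rankers.Equiv _≟_ m n u v →
    Rankers.Equiv _≟_ (m ∸ 1) (n ∸ 1) u₀ v₀
lemma5 _≟_ _ m n (s≤s (s≤s _)) (s≤s (s≤s _)) a b u v u₋ u₀ u₊ v₋ v₀ v₊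
       u≡ v≡ a∉u a∉v b∉u b∉v u≡v =
  Equiv-frame _≟_ a b u≡v (factorisation-frame _≟_ a b u u₋ u₀ u₊ u≡ a∉u b∉u)
                          (factorisation-frame _≟_ a b v v₋ v₀ v₊ v≡ a∉v b∉v)
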